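{- Let $\widetilde{\Sigma}$ be a $K$-stack call-return alphabet. For every generalized MNWA $\mathcal{B}$ over $\widetilde{\Sigma}$ there is an MNWA $\mathcal{B}'$ over $\widetilde{\Sigma}$ such that $\mathcal{L}(\mathcal{B}')=\mathcal{L}(\mathcal{B})$.
   Context: For $n\in\mathbb{N}$ let $[n]=\{1,\dots,n\}$. A $K$-stack call-return alphabet ($K\ge1$) is $\widetilde{\Sigma}=\langle\{(\Sigma_c^s,\Sigma_r^s)\}_{s\in[K]},\Sigma_{int}\rangle$ of pairwise disjoint finite sets; $\Sigma_c=\bigcup_s\Sigma_c^s$, $\Sigma_r=\bigcup_s\Sigma_r^s$, $\Sigma=\Sigma_c\cup\Sigma_r\cup\Sigma_{int}$. A string is $s$-well formed if generated by $A::=aAb\mid AA\mid\varepsilon\mid c$ with $a\in\Sigma_c^s$, $b\in\Sigma_r^s$, $c\in\Sigma\setminus(\Sigma_c^s\cup\Sigma_r^s)$. A nested word over $\widetilde{\Sigma}$ is $([n],\lessdot,\mu,\lambda)$ with $n\ge1$, $\lessdot=\{(i,i+1)\mid i\in[n-1]\}$, $\lambda:[n]\to\Sigma$, $\mu=\bigcup_s\mu^s$ with $(i,j)\in\mu^s$ iff $i<j$, $\lambda(i)\in\Sigma_c^s$, $\lambda(j)\in\Sigma_r^s$, $\lambda(i+1)\dots\lambda(j-1)$ $s$-well formed. $\mu$ is a partial injection; $\mu(i)=j$, $\mu^{ -1}(j)=i$ for $(i,j)\in\mu$. A generalized multi-stack nested-word automaton (generalized MNWA) over $\widetilde{\Sigma}$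 is $\mathcal{B}=(Q,\delta,Q_I,F,C)$ with finite $Q$, $Q_I,F,C\subseteq Q$ (initial, final, calling states), $\delta=\langle\delta_1,\delta_2\rangle$, $\delta_1\subseteq Q\times\Sigma\times Q$, $\delta_2\subseteq Q\times Q\times\Sigma_r\times Q$. It is an MNWA if $C=\emptyset$. A run on a nested word $([n],\lessdot,\mu,\lambda)$ is $\rho:[n]\to Q$ with $(q,\lambda(1),\rho(1))\in\delta_1$ for some $q\in Q_I$ and, for $i\in\{2,\dots,n\}$, $(\rho(\mu^{ -1}(i)),\rho(i-1),\lambda(i),\rho(i))\in\delta_2$ if $\mu^{ -1}(i)$ is defined and $(\rho(i-1),\lambda(i),\rho(i))\in\delta_1$ otherwise. It is accepting if $\rho(n)\in F$ and $\mu(i)$ is defined for all $i$ with $\rho(i)\in C$. $\mathcal{L}(\mathcal{B})$ is the set of nested words over $\widetilde{\Sigma}$ with an accepting run. -}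

module Defs where

open import Data.Nat using (ℕ; zero; suc; _<_; _∸_; NonZero)
open import Data.Fin using (Fin)
open import Data.Bool using (Bool; true; false)
open import Data.List using (List; []; _∷_; _++_; [_]; take; drop; length)
open import Data.Maybe using (Maybe; just; nothing)
open import Data.Product using (Σ; ∃; _×_; _,_)
open import Data.Unit using (⊤)
open import Relation.Nullary using (¬_)
open import Relation.Binary.PropositionalEquality using (_≡_; _≢_)

-- A K-stack call-return alphabet: for each stack s ∈ Fin K a finite set of
-- call symbols Σ_c^s (of size ncall s) and return symbols Σ_r^s (of size nret s),
-- and a finite set of internal symbols Σ_int (of size nint).
-- Pairwise disjointness is built in via the tagged union Sym below.
record Alphabet (K : ℕ) : Set where
  field
    ncall : Fin K → ℕ
    nret  : Fin K → ℕ
    nint  : ℕ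

module _ {K : ℕ} (A : Alphabet K) where
  open Alphabet A

  data Sym : Set where
    call : (s : Fin K) → Fin (ncall s) → Sym
    ret  : (s : Fin K) → Fin (nret s) → Sym
    int  : Fin nint → Sym

  RetSym : Set
  RetSym = Σ (Fin K) λ s → Fin (nret s)

  NotOfStack : Fin K → Sym → Set
  NotOfStack s (call t _) = t ≢ s
  NotOfStack s (ret t _)  = t ≢ s
  NotOfStack s (int _)    = ⊤

  data WellFormed (s : Fin K) : List Sym → Set where
    wf-nest  : ∀ {w} (a : Fin (ncall s)) (b : Fin (nret s)) →
               WellFormed s w → WellFormed s (call s a ∷ (w ++ [ ret s b ]))
    wf-cat   : ∀ {u v} → WellFormed s u → WellFormed s v → WellFormed s (u ++ v)
    wf-eps   : WellFormed s []
    wf-other : ∀ c → NotOfStack s c → WellFormed s [ c ]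

_!_ : {X : Set} → List X → ℕ → Maybe X
[] ! _ = nothing
(x ∷ xs) ! zero = just x
(x ∷ xs) ! suc i = xs ! i

-- λ(i+1) … λ(j-1)  (0-based)
between : {X : Set} → ℕ → ℕ → List X → List X
between i j w = take (j ∸ suc i) (drop (suc i) w)

module _ {K : ℕ} {A : Alphabet K} where
  open Alphabet A

  record Matched (w : List (Sym A)) (i j : ℕ) : Set where
    field
      stack   : Fin K
      callSym : Fin (ncall stack)
      retSym  : Fin (nret stack)
      i<j     : i < j
      callAt  : w ! i ≡ just (call stack callSym)
      retAt   : w ! j ≡ just (ret stack retSym)
      wf      : WellFormed A stack (between i j w)

record GMNWA {K : ℕ} (A : Alphabet K) : Set where
  field
    nstates : ℕ
    initial : Fin nstates → Bool
    final   : Fin nstates → Bool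
    calling : Fin nstates → Bool
    δ₁      : Fin nstates → Sym A → Fin nstates → Bool
    δ₂      : Fin nstates → Fin nstates → RetSym A → Fin nstates → Bool

IsMNWA : {K : ℕ} {A : Alphabet K} → GMNWA A → Set
IsMNWA B = ∀ q → GMNWA.calling B q ≡ false

module _ {K : ℕ} {A : Alphabet K} (B : GMNWA A) where
  open GMNWA B

  record IsRun (w : List (Sym A)) (ρ : ℕ → Fin nstates) : Set where
    field
      start   : ∀ a → w ! 0 ≡ just a →
                Σ (Fin nstates) λ q → (initial q ≡ true) × (δ₁ q a (ρ 0) ≡ true)
      stepRet : ∀ i k → suc i < length w → (m : Matched w k (suc i)) →
                δ₂ (ρ k) (ρ i) (Matched.stack m , Matched.retSym m) (ρ (suc i)) ≡ true
      stepInt : ∀ i a → w ! suc i ≡ just a → ¬ (∃ λ k → Matched w k (suc i)) →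
                δ₁ (ρ i) a (ρ (suc i)) ≡ true

  record IsAccepting (w : List (Sym A)) (ρ : ℕ → Fin nstates) : Set where
    field
      run       : IsRun w ρ
      finalLast : final (ρ (length w ∸ 1)) ≡ true
      callsMatched : ∀ i → i < length w → calling (ρ i) ≡ true →
                     ∃ λ j → Matched w i j

  -- 𝓛(B): nested words (n ≥ 1, determined by their labelling) with an accepting run
  Lang : List (Sym A) → Set
  Lang w = NonZero (length w) × (∃ λ ρ → IsAccepting w ρ)

module Submission where

-- B′ runs B and keeps, at each position, a set of stacks that over-approximates the stacks holding a
-- call read in a calling state and not yet returned: such a call forces its stack into the set, and
-- the set only grows, except that a return on stack s may drop s when s was not in the set just
-- before the matching call. That earlier set is stored as a third state component, which δ₂ reads at
-- the call position. B′ has no calling states and accepts only with an empty set.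
-- An accepting run of B extends to one of B′ by the exact sets. Conversely, if in an accepting run of
-- B′ the call at a calling position i on stack s were never returned, s would stay in the set up to
-- the last position: a later return on s cannot be matched with a call at or before i, so its call
-- lies after i, where s was already in the set.

open import Defs
open import Data.Bool using (true; false; if_then_else_)
import Data.Bool as Bool
open import Data.Empty using (⊥-elim)
open import Data.Fin using (Fin; zero; suc; _≟_; combine; remQuot)
open import Data.Fin.Properties using (2↔Bool; remQuot-combine)
open import Data.Fin.Subset using (Subset; outside; _∈_; _∉_; _⊆_; _─_; _-_; ⁅_⁆; Empty; ⊥)
open import Data.Fin.Subset.Properties
  using (_∈?_; _⊆?_; nonempty?; ⊥⊆; ∉⊥; p─q⊆p; x∉⁅y⁆⇒x≢y; x∈p∧x≢y⇒x∈p-y)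
open import Data.List using (List; []; _∷_; _++_; [_]; foldl; length; take; drop)
open import Data.List.Properties using (++-assoc; ++-identityʳ; foldl-++; take-[]; drop-drop; ∷-injective)
open import Data.Maybe using (Maybe; just; nothing; _>>=_)
open import Data.Maybe.Properties using (just-injective)
open import Data.Nat using (ℕ; NonZero; zero; suc; _+_; _*_; _^_; _∸_; _<_; _≤_; z≤n; s≤s)
open import Data.Nat.Induction using (<-rec)
open import Data.Nat.Properties
  using ( ≤-refl; ≤-trans; <-trans; <⇒≤; ≤-pred; <-cmp; n≤1+n; n<1+n; m≤m+n; m≤n⇒m<n∨m≡n
        ; +-suc; 0≢1+n; m+[n∸m]≡n; m+n∸m≡n; m+n∸n≡m; +-∸-comm; n∸n≡0; anyUpTo? )
open import Data.Product using (Σ; ∃; _×_; _,_; proj₁; proj₂; uncurry′)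
open import Data.Sum using (_⊎_; inj₁; inj₂)
open import Data.Unit using (tt)
open import Data.Vec using ([]; _∷_; here; there; tabulate)
open import Data.Vec.Properties using (lookup∘tabulate; lookup⇒[]=; []=⇒lookup)
open import Function using (_∘_)
open import Function.Bundles using (Inverse)
open import Relation.Binary.Definitions using (tri<; tri≈; tri>)
open import Relation.Binary.PropositionalEquality
  using (_≡_; _≢_; refl; sym; trans; cong; cong₂; subst; subst₂; module ≡-Reasoning)
open import Relation.Nullary using (¬_; Dec; does; yes; no)
open import Relation.Nullary.Decidable
  using (dec-true; dec-false; decidable-stable; map′; _×-dec_; _→-dec_; ¬?)

dec-true⁻ : ∀ {P : Set} (P? : Dec P) → does P? ≡ true → P
dec-true⁻ (yes p) _ = p

dec-cases : ∀ {P Q : Set} → Dec P → (Q → P) → (¬ Q → P) → P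
dec-cases P? yes-Q no-Q = decidable-stable P? λ ¬P → ¬P (no-Q (¬P ∘ yes-Q))

true≢false : true ≢ false
true≢false ()

<⇒≤∸1 : ∀ {j n} → j < n → j ≤ n ∸ 1
<⇒≤∸1 (s≤s j≤n) = j≤n

≤∸1⇒< : ∀ {j n} → .{{NonZero n}} → j ≤ n ∸ 1 → j < n
≤∸1⇒< {n = suc n} j≤n = s≤s j≤n

Defined : Maybe ℕ → Set
Defined m = ∃ λ e → m ≡ just e

defined? : ∀ m → Dec (Defined m)
defined? (just e) = yes (e , refl)
defined? nothing  = no λ { (_ , ()) }

!-drop : ∀ {X : Set} m n (w : List X) → w ! (m + n) ≡ drop m w ! n
!-drop zero    n w       = refl
!-drop (suc m) n []      = refl
!-drop (suc m) n (_ ∷ w) = !-drop m n w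

drop-! : ∀ {X : Set} j (w : List X) {x} → w ! j ≡ just x → drop j w ≡ x ∷ drop (suc j) w
drop-! zero    (_ ∷ w) refl = refl
drop-! (suc j) (_ ∷ w) eq   = drop-! j w eq

!-defined : ∀ {X : Set} i (w : List X) → i < length w → ∃ λ x → w ! i ≡ just x
!-defined zero    (x ∷ w) _       = x , refl
!-defined (suc i) (_ ∷ w) (s≤s i<) = !-defined i w i<

!-< : ∀ {X : Set} j (w : List X) {x} → w ! j ≡ just x → j < length w
!-< zero    (_ ∷ w) _  = s≤s z≤n
!-< (suc j) (_ ∷ w) eq = s≤s (!-< j w eq)

take-+ : ∀ {X : Set} m n (w : List X) → take (m + n) w ≡ take m w ++ take n (drop m w)
take-+ zero    n w       = refl
take-+ (suc m) n []      = sym (take-[] n)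
take-+ (suc m) n (x ∷ w) = cong (x ∷_) (take-+ m n w)

take-! : ∀ {X : Set} ℓ (w : List X) u₁ x u₂ → take ℓ w ≡ u₁ ++ x ∷ u₂ →
         w ! length u₁ ≡ just x × take (length u₁) w ≡ u₁
take-! (suc ℓ) (y ∷ w) [] x u₂ refl = refl , refl
take-! (suc ℓ) (y ∷ w) (z ∷ u₁) x u₂ eq with ∷-injective eq
... | refl , eq′ with take-! ℓ w u₁ x u₂ eq′
...   | at , pre = at , cong (y ∷_) pre
take-! zero    _       []      _ _ ()
take-! zero    _       (_ ∷ _) _ _ ()
take-! (suc ℓ) []      []      _ _ ()
take-! (suc ℓ) []      (_ ∷ _) _ _ ()

x∈p─q⇒x∉q : ∀ {n} {x : Fin n} (p q : Subset n) → x ∈ p ─ q → x ∉ q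
x∈p─q⇒x∉q (_ ∷ p) (outside ∷ q) here       ()
x∈p─q⇒x∉q (_ ∷ p) (_ ∷ q)       (there x∈) (there x∈q) = x∈p─q⇒x∉q p q x∈ x∈q

x∈p-y⇒x≢y : ∀ {n} {x y : Fin n} (p : Subset n) → x ∈ p - y → x ≢ y
x∈p-y⇒x≢y {y = y} p x∈ = x∉⁅y⁆⇒x≢y (x∈p─q⇒x∉q p ⁅ y ⁆ x∈)

subset : ∀ {n} {P : Fin n → Set} → (∀ x → Dec (P x)) → Subset n
subset P? = tabulate (does ∘ P?)

∈-subset⁺ : ∀ {n} {P : Fin n → Set} (P? : ∀ x → Dec (P x)) {x} → P x → x ∈ subset P?
∈-subset⁺ P? {x} px = lookup⇒[]= x _ (trans (lookup∘tabulate (does ∘ P?) x) (dec-true (P? x) px))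

∈-subset⁻ : ∀ {n} {P : Fin n → Set} (P? : ∀ x → Dec (P x)) {x} → x ∈ subset P? → P x
∈-subset⁻ P? {x} x∈ = dec-true⁻ (P? x) (trans (sym (lookup∘tabulate (does ∘ P?) x)) ([]=⇒lookup x∈))

encodeSubset : ∀ {n} → Subset n → Fin (2 ^ n)
encodeSubset []      = zero
encodeSubset (b ∷ p) = combine (Inverse.from 2↔Bool b) (encodeSubset p)

decodeSubset : ∀ n → Fin (2 ^ n) → Subset n
decodeSubset zero    _ = []
decodeSubset (suc n) i = uncurry′ (λ b j → Inverse.to 2↔Bool b ∷ decodeSubset n j) (remQuot (2 ^ n) i)

decode-encodeSubset : ∀ {n} (p : Subset n) → decodeSubset n (encodeSubset p) ≡ p
decode-encodeSubset [] = refl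
decode-encodeSubset {suc n} (b ∷ p) = begin
  uncurry′ (λ c j → Inverse.to 2↔Bool c ∷ decodeSubset n j) (remQuot (2 ^ n) (encodeSubset (b ∷ p)))
    ≡⟨ cong (uncurry′ (λ c j → Inverse.to 2↔Bool c ∷ decodeSubset n j))
            (remQuot-combine (Inverse.from 2↔Bool b) (encodeSubset p)) ⟩
  Inverse.to 2↔Bool (Inverse.from 2↔Bool b) ∷ decodeSubset n (encodeSubset p)
    ≡⟨ cong₂ _∷_ (Inverse.strictlyInverseˡ 2↔Bool b) (decode-encodeSubset p) ⟩
  b ∷ p ∎
  where open ≡-Reasoning

module _ {K : ℕ} {A : Alphabet K} where

  call-injective : ∀ {s t a b} → just (call {A = A} s a) ≡ just (call t b) → s ≡ t
  call-injective refl = refl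

  ret-injective : ∀ {s t a b} → just (ret {A = A} s a) ≡ just (ret t b) → s ≡ t
  ret-injective refl = refl

module StackHeight {K : ℕ} (A : Alphabet K) (s : Fin K) where
  open Alphabet A

  lower : ℕ → Maybe ℕ
  lower zero    = nothing
  lower (suc d) = just d

  step : ℕ → Sym A → Maybe ℕ
  step d (call t _) = if does (t ≟ s) then just (suc d) else just d
  step d (ret t _)  = if does (t ≟ s) then lower d else just d
  step d (int _)    = just d

  -- nothing once stack s has underflowed
  height : Maybe ℕ → List (Sym A) → Maybe ℕ
  height = foldl λ m c → m >>= λ d → step d c

  step-push : ∀ d a → step d (call s a) ≡ just (suc d)
  step-push d a rewrite dec-true (s ≟ s) refl = refl

  step-pop : ∀ d b → step d (ret s b) ≡ lower d
  step-pop d b rewrite dec-true (s ≟ s) refl = refl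

  step-other : ∀ d c → NotOfStack A s c → step d c ≡ just d
  step-other d (call t _) t≢s rewrite dec-false (t ≟ s) t≢s = refl
  step-other d (ret t _)  t≢s rewrite dec-false (t ≟ s) t≢s = refl
  step-other d (int _)    _   = refl

  data Role : Sym A → Set where
    push  : ∀ a → Role (call s a)
    pop   : ∀ b → Role (ret s b)
    other : ∀ {c} → NotOfStack A s c → Role c

  role : ∀ c → Role c
  role (call t a) with t ≟ s
  ... | yes refl = push a
  ... | no t≢s   = other t≢s
  role (ret t b) with t ≟ s
  ... | yes refl = pop b
  ... | no t≢s   = other t≢s
  role (int _) = other tt

  step-underflow : ∀ d c → step d c ≡ nothing → d ≡ 0 × ∃ λ b → c ≡ ret s b
  step-underflow d c eq with role c
  step-underflow d _ eq | push a with trans (sym (step-push d a)) eq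
  ... | ()
  step-underflow d _ eq | pop b with d | trans (sym (step-pop d b)) eq
  ... | zero | _ = refl , b , refl
  step-underflow d c eq | other c∉s with trans (sym (step-other d c c∉s)) eq
  ... | ()

  height-nothing : ∀ u → height nothing u ≡ nothing
  height-nothing []      = refl
  height-nothing (_ ∷ u) = height-nothing u

  height-++ : ∀ m u v → height m (u ++ v) ≡ height (height m u) v
  height-++ = foldl-++ _

  height-just⁻ : ∀ m u {e} → height m u ≡ just e → ∃ λ d → m ≡ just d
  height-just⁻ (just d) u eq = d , refl
  height-just⁻ nothing  u eq with trans (sym (height-nothing u)) eq
  ... | ()

  step-shift : ∀ d c {f} m → step d c ≡ just f → step (d + m) c ≡ just (f + m)
  step-shift d c m eq with role c
  step-shift d _ m eq | push a with trans (sym (step-push d a)) eq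
  ... | refl = step-push (d + m) a
  step-shift d _ m eq | pop b with d | trans (sym (step-pop d b)) eq
  ... | suc d′ | refl = step-pop (suc d′ + m) b
  step-shift d c m eq | other c∉s with trans (sym (step-other d c c∉s)) eq
  ... | refl = step-other (d + m) c c∉s

  height-shift : ∀ d u {f} m → height (just d) u ≡ just f → height (just (d + m)) u ≡ just (f + m)
  height-shift d [] m refl = refl
  height-shift d (c ∷ u) m eq with step d c in eqc
  ... | just d′ rewrite step-shift d c m eqc = height-shift d′ u m eq
  ... | nothing rewrite height-nothing u with eq
  ... | ()

  wellFormed⇒height : ∀ {u} → WellFormed A s u → ∀ d → height (just d) u ≡ just d
  wellFormed⇒height (wf-nest {w} a b wf) d = begin
    height (just d) (call s a ∷ w ++ [ ret s b ])  ≡⟨ cong (λ m → height m (w ++ [ ret s b ])) (step-push d a) ⟩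
    height (just (suc d)) (w ++ [ ret s b ])       ≡⟨ height-++ (just (suc d)) w [ ret s b ] ⟩
    height (height (just (suc d)) w) [ ret s b ]   ≡⟨ cong (λ m → height m [ ret s b ]) (wellFormed⇒height wf (suc d)) ⟩
    step (suc d) (ret s b)                         ≡⟨ step-pop (suc d) b ⟩
    just d                                         ∎
    where open ≡-Reasoning
  wellFormed⇒height (wf-cat {u} {v} wfu wfv) d
    rewrite height-++ (just d) u v | wellFormed⇒height wfu d = wellFormed⇒height wfv d
  wellFormed⇒height wf-eps d = refl
  wellFormed⇒height (wf-other c c∉s) d = step-other d c c∉s

  data OpenCalls : ℕ → List (Sym A) → Set where
    none : ∀ {u} → WellFormed A s u → OpenCalls 0 u
    more : ∀ {n u v} → OpenCalls n u → (a : Fin (ncall s)) → WellFormed A s v →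
           OpenCalls (suc n) (u ++ call s a ∷ v)

  openCalls-++ : ∀ {n u v} → OpenCalls n u → WellFormed A s v → OpenCalls n (u ++ v)
  openCalls-++ (none wfu) wfv = none (wf-cat wfu wfv)
  openCalls-++ {v = v} (more {u = u} {v = v′} o a wfv′) wfv
    rewrite ++-assoc u (call s a ∷ v′) v = more o a (wf-cat wfv′ wfv)

  openCalls-step : ∀ {d d′ u} c → step d c ≡ just d′ → OpenCalls d u → OpenCalls d′ (u ++ [ c ])
  openCalls-step {d} c eq o with role c
  ... | push a with trans (sym (step-push d a)) eq
  ...   | refl = more o a wf-eps
  openCalls-step {d} c eq o | pop b with d | trans (sym (step-pop d b)) eq | o
  ... | suc _ | refl | more {u = u} {v = v} o′ a wf
    rewrite ++-assoc u (call s a ∷ v) [ ret s b ] = openCalls-++ o′ (wf-nest a b wf)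
  openCalls-step {d} c eq o | other c∉s with trans (sym (step-other d c c∉s)) eq
  ... | refl = openCalls-++ o (wf-other c c∉s)

  openCalls-height : ∀ {d e} u v → OpenCalls d u → height (just d) v ≡ just e → OpenCalls e (u ++ v)
  openCalls-height u [] o refl rewrite ++-identityʳ u = o
  openCalls-height {d} u (c ∷ v) o eq with step d c in eqc
  ... | just d′ rewrite sym (++-assoc u [ c ] v) = openCalls-height (u ++ [ c ]) v (openCalls-step c eqc o) eq
  ... | nothing rewrite height-nothing v with eq
  ... | ()

  height⇒wellFormed : ∀ u → height (just 0) u ≡ just 0 → WellFormed A s u
  height⇒wellFormed u eq with openCalls-height [] u (none wf-eps) eq
  ... | none wf = wf

  first-underflow : ∀ d u → height (just d) u ≡ nothing →
    Σ (List (Sym A)) λ u₁ → Σ (Fin (nret s)) λ b → Σ (List (Sym A)) λ u₂ →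
      u ≡ u₁ ++ ret s b ∷ u₂ × height (just d) u₁ ≡ just 0
  first-underflow d [] ()
  first-underflow d (c ∷ u) eq with step d c in eqc
  ... | just d′ with first-underflow d′ u eq
  ...   | u₁ , b , u₂ , refl , eq₁ = c ∷ u₁ , b , u₂ , refl , trans (cong (λ m → height m u₁) eqc) eq₁
  first-underflow d (c ∷ u) eq | nothing with step-underflow d c eqc
  ... | refl , b , refl = [] , b , u , refl , refl

module Segments {X : Set} (w : List X) where

  -- the labels at positions k+1 … t
  segment : ℕ → ℕ → List X
  segment k t = between k (suc t) w

  segment-split : ∀ {k a t} → k ≤ a → a ≤ t → segment k t ≡ segment k a ++ segment a t
  segment-split {k} {a} {t} k≤a a≤t = begin
    take (t ∸ k) (drop (suc k) w)
      ≡⟨ cong (λ ℓ → take ℓ (drop (suc k) w)) lengths ⟩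
    take ((a ∸ k) + (t ∸ a)) (drop (suc k) w)
      ≡⟨ take-+ (a ∸ k) (t ∸ a) (drop (suc k) w) ⟩
    take (a ∸ k) (drop (suc k) w) ++ take (t ∸ a) (drop (a ∸ k) (drop (suc k) w))
      ≡⟨ cong (λ v → segment k a ++ take (t ∸ a) v) offsets ⟩
    take (a ∸ k) (drop (suc k) w) ++ take (t ∸ a) (drop (suc a) w)
      ∎
    where
    open ≡-Reasoning
    lengths : t ∸ k ≡ (a ∸ k) + (t ∸ a)
    lengths = trans (cong (_∸ k) (sym (m+[n∸m]≡n a≤t))) (+-∸-comm (t ∸ a) k≤a)
    offsets : drop (a ∸ k) (drop (suc k) w) ≡ drop (suc a) w
    offsets = trans (drop-drop (suc k) (a ∸ k) w) (cong (λ i → drop (suc i) w) (m+[n∸m]≡n k≤a))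

  segment-empty : ∀ k → segment k k ≡ []
  segment-empty k rewrite n∸n≡0 k = refl

  segment-unit : ∀ a {x} → w ! suc a ≡ just x → segment a (suc a) ≡ [ x ]
  segment-unit a eq rewrite m+n∸n≡m 1 a | drop-! (suc a) w eq = refl

  segment-snoc : ∀ {k t x} → k ≤ t → w ! suc t ≡ just x → segment k (suc t) ≡ segment k t ++ [ x ]
  segment-snoc {k} {t} k≤t eq
    rewrite segment-split k≤t (n≤1+n t) | segment-unit t eq = refl

  segment-! : ∀ i t u₁ x u₂ → segment i t ≡ u₁ ++ x ∷ u₂ →
              w ! (suc i + length u₁) ≡ just x × segment i (i + length u₁) ≡ u₁
  segment-! i t u₁ x u₂ eq with take-! (t ∸ i) (drop (suc i) w) u₁ x u₂ eq
  ... | at , pre = trans (!-drop (suc i) (length u₁) w) at ,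
                   trans (cong (λ ℓ → take ℓ (drop (suc i) w)) (m+n∸m≡n i (length u₁))) pre

module Nesting {K : ℕ} {A : Alphabet K} (w : List (Sym A)) where
  open Segments w
  open StackHeight A
  open Matched

  last : ℕ
  last = length w ∸ 1

  depthSince : Fin K → ℕ → ℕ → Maybe ℕ
  depthSince s k t = height s (just 0) (segment k t)

  depthSince-split : ∀ s {k a t} → k ≤ a → a ≤ t → depthSince s k t ≡ height s (depthSince s k a) (segment a t)
  depthSince-split s {k} {a} {t} k≤a a≤t =
    trans (cong (height s (just 0)) (segment-split k≤a a≤t)) (height-++ s (just 0) (segment k a) (segment a t))

  depthSince-prefix : ∀ s {k a t e} → k ≤ a → a ≤ t → depthSince s k t ≡ just e →
                      ∃ λ d → depthSince s k a ≡ just d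
  depthSince-prefix s {k} {a} {t} k≤a a≤t eq =
    height-just⁻ s (depthSince s k a) (segment a t) (trans (sym (depthSince-split s k≤a a≤t)) eq)

  matched-closes : ∀ {i j t} (m : Matched w i j) → j ≤ t → depthSince (stack m) i t ≡ nothing
  matched-closes {i} {suc j} {t} m j<t = begin
    depthSince s i t                                      ≡⟨ depthSince-split s i≤j j<t ⟩
    height s (depthSince s i (suc j)) (segment (suc j) t) ≡⟨ cong (λ h → height s h (segment (suc j) t)) closes ⟩
    height s nothing (segment (suc j) t)                  ≡⟨ height-nothing s (segment (suc j) t) ⟩
    nothing                                               ∎
    where
    open ≡-Reasoning
    s = stack m
    i≤j : i ≤ suc j
    i≤j = <⇒≤ (i<j m)
    closes : depthSince s i (suc j) ≡ nothing
    closes = begin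
      height s (just 0) (segment i (suc j))
        ≡⟨ cong (height s (just 0)) (segment-snoc (≤-pred (i<j m)) (retAt m)) ⟩
      height s (just 0) (segment i j ++ [ ret s (retSym m) ])
        ≡⟨ height-++ s (just 0) (segment i j) [ ret s (retSym m) ] ⟩
      height s (height s (just 0) (segment i j)) [ ret s (retSym m) ]
        ≡⟨ cong (λ h → height s h [ ret s (retSym m) ]) (wellFormed⇒height s (wf m) 0) ⟩
      step s 0 (ret s (retSym m))
        ≡⟨ step-pop s 0 (retSym m) ⟩
      nothing
        ∎

  matched-span-wellFormed : ∀ {k t} (m : Matched w (suc k) (suc t)) → WellFormed A (stack m) (segment k (suc t))
  matched-span-wellFormed {k} m
    rewrite segment-split (n≤1+n k) (<⇒≤ (i<j m))
          | segment-unit k (callAt m)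
          | segment-snoc (≤-pred (i<j m)) (retAt m)
    = wf-nest (callSym m) (retSym m) (wf m)

  depthSince-across-match : ∀ {k′ k t x} → k′ ≤ k → (m : Matched w (suc k) (suc t)) →
                            depthSince (stack m) k′ k ≡ just x → depthSince (stack m) k′ (suc t) ≡ just x
  depthSince-across-match {k′} {k} {t} {x} k′≤k m eq = begin
    depthSince s k′ (suc t)                              ≡⟨ depthSince-split s k′≤k (≤-trans (n≤1+n k) (<⇒≤ (i<j m))) ⟩
    height s (depthSince s k′ k) (segment k (suc t))     ≡⟨ cong (λ h → height s h (segment k (suc t))) eq ⟩
    height s (just x) (segment k (suc t))                ≡⟨ wellFormed⇒height s (matched-span-wellFormed m) x ⟩
    just x                                               ∎
    where
    open ≡-Reasoning
    s = stack m

  inner-call-closes : ∀ {s k i t a y} → depthSince s k t ≡ just 0 → k < i → i ≤ t →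
                      w ! i ≡ just (call s a) → depthSince s i t ≢ just y
  inner-call-closes {s} {k} {suc i} {t} {a} {y} balanced (s≤s k≤i) i<t at reopened
    with depthSince-prefix s k≤i (≤-trans (n≤1+n i) i<t) balanced
  ... | x , before = 0≢1+n (just-injective (trans (sym balanced) raised))
    where
    open ≡-Reasoning
    raised : depthSince s k t ≡ just (suc (y + x))
    raised = begin
      depthSince s k t
        ≡⟨ depthSince-split s k≤i (≤-trans (n≤1+n i) i<t) ⟩
      height s (depthSince s k i) (segment i t)
        ≡⟨ cong₂ (height s) before (segment-split (n≤1+n i) i<t) ⟩
      height s (just x) (segment i (suc i) ++ segment (suc i) t)
        ≡⟨ cong (λ u → height s (just x) (u ++ segment (suc i) t)) (segment-unit i at) ⟩
      height s (step s x (call s a)) (segment (suc i) t)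
        ≡⟨ cong (λ h → height s h (segment (suc i) t)) (step-push s x a) ⟩
      height s (just (0 + suc x)) (segment (suc i) t)
        ≡⟨ height-shift s 0 (segment (suc i) t) (suc x) reopened ⟩
      just (y + suc x)
        ≡⟨ cong just (+-suc y x) ⟩
      just (suc (y + x))
        ∎

  underflow⇒matched : ∀ {s i t a} → w ! i ≡ just (call s a) → depthSince s i t ≡ nothing →
                      ∃ λ j → Matched w i j
  underflow⇒matched {s} {i} {t} {a} at underflow with first-underflow s 0 (segment i t) underflow
  ... | u₁ , b , u₂ , split , balanced with segment-! i t u₁ (ret s b) u₂ split
  ...   | retAt′ , prefix = suc i + length u₁ , record
    { stack = s ; callSym = a ; retSym = b ; i<j = s≤s (m≤m+n i (length u₁))
    ; callAt = at ; retAt = retAt′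
    ; wf = height⇒wellFormed s (segment i (i + length u₁)) (trans (cong (height s (just 0)) prefix) balanced) }

  open-call-before-matched-call : ∀ {s i a t′ e k t} → w ! i ≡ just (call s a) → depthSince s i t′ ≡ just e →
                                  i ≤ t → suc t ≤ t′ → (m : Matched w k (suc t)) → stack m ≡ s → i < k
  open-call-before-matched-call {s} {i} {k = k} {t} at open′ i≤t t<t′ m refl with <-cmp k i
  ... | tri< k<i _ _ = ⊥-elim (inner-call-closes (wellFormed⇒height s (wf m) 0) k<i i≤t at
                                  (proj₂ (depthSince-prefix s i≤t (≤-trans (n≤1+n t) t<t′) open′)))
  ... | tri≈ _ refl _ with trans (sym open′) (matched-closes m t<t′)
  ...   | ()
  open-call-before-matched-call _ _ _ _ _ _ | tri> _ _ i<k = i<k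

module Construction {K : ℕ} (A : Alphabet K) (B : GMNWA A) where
  open GMNWA B

  record State : Set where
    constructor ⟨_,_,_⟩
    field
      control       : Fin nstates
      pending       : Subset K
      pendingBefore : Subset K
  open State public

  Guarded : Sym A → Fin nstates → Subset K → Set
  Guarded (call s _) q o = calling q ≡ true → s ∈ o
  Guarded (ret _ _)  q o = calling q ≡ false
  Guarded (int _)    q o = calling q ≡ false

  Initial : State → Set
  Initial x = initial (control x) ≡ true × Empty (pending x)

  Final : State → Set
  Final x = final (control x) ≡ true × Empty (pending x)

  record Internal (x : State) (a : Sym A) (y : State) : Set where
    constructor internal
    field
      transition : δ₁ (control x) a (control y) ≡ true
      recorded   : pending x ⊆ pendingBefore y
      kept       : pending x ⊆ pending y
      guarded    : Guarded a (control y) (pending y)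

  record Return (k x : State) (r : RetSym A) (y : State) : Set where
    constructor return
    field
      transition : δ₂ (control k) (control x) r (control y) ≡ true
      recorded   : pending x ⊆ pendingBefore y
      notCalling : calling (control y) ≡ false
      othersKept : pending x - proj₁ r ⊆ pending y
      restored   : proj₁ r ∈ pendingBefore k → proj₁ r ∈ pending y

  guarded? : ∀ a q o → Dec (Guarded a q o)
  guarded? (call s _) q o = (calling q Bool.≟ true) →-dec (s ∈? o)
  guarded? (ret _ _)  q o = calling q Bool.≟ false
  guarded? (int _)    q o = calling q Bool.≟ false

  initial? : ∀ x → Dec (Initial x)
  initial? x = (initial (control x) Bool.≟ true) ×-dec ¬? (nonempty? (pending x))

  final? : ∀ x → Dec (Final x)
  final? x = (final (control x) Bool.≟ true) ×-dec ¬? (nonempty? (pending x))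

  internal? : ∀ x a y → Dec (Internal x a y)
  internal? x a y =
    map′ (λ (t , r , k , g) → internal t (λ {s} → r {s}) (λ {s} → k {s}) g)
         (λ (internal t r k g) → t , (λ {s} → r {s}) , (λ {s} → k {s}) , g)
      ((δ₁ (control x) a (control y) Bool.≟ true) ×-dec (pending x ⊆? pendingBefore y) ×-dec
       (pending x ⊆? pending y) ×-dec guarded? a (control y) (pending y))

  return? : ∀ k x r y → Dec (Return k x r y)
  return? k x r y =
    map′ (λ (t , r , n , o , s) → return t (λ {z} → r {z}) n (λ {z} → o {z}) s)
         (λ (return t r n o s) → t , (λ {z} → r {z}) , n , (λ {z} → o {z}) , s)
      ((δ₂ (control k) (control x) r (control y) Bool.≟ true) ×-dec (pending x ⊆? pendingBefore y) ×-dec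
       (calling (control y) Bool.≟ false) ×-dec (pending x - proj₁ r ⊆? pending y) ×-dec
       (proj₁ r ∈? pendingBefore k →-dec proj₁ r ∈? pending y))

  stateCount : ℕ
  stateCount = nstates * (2 ^ K * 2 ^ K)

  encode : State → Fin stateCount
  encode ⟨ q , o , p ⟩ = combine q (combine (encodeSubset o) (encodeSubset p))

  decodeParts : Fin nstates → Fin (2 ^ K) × Fin (2 ^ K) → State
  decodeParts q (o , p) = ⟨ q , decodeSubset K o , decodeSubset K p ⟩

  decode : Fin stateCount → State
  decode i = uncurry′ (λ q j → decodeParts q (remQuot (2 ^ K) j)) (remQuot (2 ^ K * 2 ^ K) i)

  decode-encode : ∀ x → decode (encode x) ≡ x
  decode-encode ⟨ q , o , p ⟩ =
    trans (cong (uncurry′ λ q j → decodeParts q (remQuot (2 ^ K) j)) (remQuot-combine q _))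
    (trans (cong (decodeParts q) (remQuot-combine (encodeSubset o) (encodeSubset p)))
           (cong₂ ⟨ q ,_,_⟩ (decode-encodeSubset o) (decode-encodeSubset p)))

  B′ : GMNWA A
  B′ = record
    { nstates = stateCount
    ; initial = λ i → does (initial? (decode i))
    ; final   = λ i → does (final? (decode i))
    ; calling = λ _ → false
    ; δ₁      = λ i a j → does (internal? (decode i) a (decode j))
    ; δ₂      = λ i j r k → does (return? (decode i) (decode j) r (decode k))
    }

  B′-isMNWA : IsMNWA B′
  B′-isMNWA _ = refl

  encode-initial : ∀ x → Initial x → GMNWA.initial B′ (encode x) ≡ true
  encode-initial x h = subst (λ z → does (initial? z) ≡ true) (sym (decode-encode x)) (dec-true (initial? x) h)

  encode-final : ∀ x → Final x → GMNWA.final B′ (encode x) ≡ true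
  encode-final x h = subst (λ z → does (final? z) ≡ true) (sym (decode-encode x)) (dec-true (final? x) h)

  encode-internal : ∀ x a y → Internal x a y → GMNWA.δ₁ B′ (encode x) a (encode y) ≡ true
  encode-internal x a y h =
    subst₂ (λ u v → does (internal? u a v) ≡ true) (sym (decode-encode x)) (sym (decode-encode y))
           (dec-true (internal? x a y) h)

  encode-return : ∀ k x r y → Return k x r y → GMNWA.δ₂ B′ (encode k) (encode x) r (encode y) ≡ true
  encode-return k x r y h =
    subst (λ z → does (return? z (decode (encode x)) r (decode (encode y))) ≡ true) (sym (decode-encode k))
      (subst₂ (λ u v → does (return? k u r v) ≡ true) (sym (decode-encode x)) (sym (decode-encode y))
              (dec-true (return? k x r y) h))

  module Soundness (w : List (Sym A)) (ρ′ : ℕ → Fin stateCount) (acc : IsAccepting B′ w ρ′) where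
    open IsAccepting acc
    open IsRun run
    open Nesting w
    open Matched

    x : ℕ → State
    x t = decode (ρ′ t)

    q : ℕ → Fin nstates
    q t = control (x t)

    initial-step : ∀ {c} → w ! 0 ≡ just c → ∃ λ x₀ → Initial x₀ × Internal x₀ c (x 0)
    initial-step {c} at with start c at
    ... | i , init , step =
      decode i , dec-true⁻ (initial? (decode i)) init , dec-true⁻ (internal? (decode i) c (x 0)) step

    internal-step : ∀ {t c} → w ! suc t ≡ just c → ¬ (∃ λ k → Matched w k (suc t)) →
                    Internal (x t) c (x (suc t))
    internal-step {t} {c} at unmatched = dec-true⁻ (internal? (x t) c (x (suc t))) (stepInt t c at unmatched)

    return-step : ∀ {t k} → suc t < length w → (m : Matched w k (suc t)) →
                  Return (x k) (x t) (stack m , retSym m) (x (suc t))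
    return-step {t} {k} lt m = dec-true⁻ (return? (x k) (x t) (stack m , retSym m) (x (suc t))) (stepRet t k lt m)

    pending⊆pendingBefore : ∀ {t} → suc t < length w → pending (x t) ⊆ pendingBefore (x (suc t))
    pending⊆pendingBefore {t} lt with !-defined (suc t) w lt
    ... | c , at = dec-cases (pending (x t) ⊆? pendingBefore (x (suc t)))
                     (λ (k , m) → Return.recorded (return-step lt m))
                     (λ unmatched → Internal.recorded (internal-step at unmatched))

    guarded-at : ∀ i {c} → w ! i ≡ just c → calling (q i) ≡ true → Guarded c (q i) (pending (x i))
    guarded-at zero at _ = Internal.guarded (proj₂ (proj₂ (initial-step at)))
    guarded-at (suc i) {c} at calls = dec-cases (guarded? c (q (suc i)) (pending (x (suc i))))
      (λ (k , m) → ⊥-elim (true≢false (trans (sym calls) (Return.notCalling (return-step (!-< (suc i) w at) m)))))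
      (λ unmatched → Internal.guarded (internal-step at unmatched))

    calling-call : ∀ {i} → i < length w → calling (q i) ≡ true →
                   ∃ λ s → Σ (Fin (Alphabet.ncall A s)) λ a → w ! i ≡ just (call s a) × s ∈ pending (x i)
    calling-call {i} lt calls with !-defined i w lt
    ... | call s a , at = s , a , at , guarded-at i at calls calls
    ... | ret _ _  , at = ⊥-elim (true≢false (trans (sym calls) (guarded-at i at calls)))
    ... | int _    , at = ⊥-elim (true≢false (trans (sym calls) (guarded-at i at calls)))

    survives-return : ∀ {t k s} → suc t < length w → (m : Matched w k (suc t)) → s ∈ pending (x t) →
                      (stack m ≡ s → s ∈ pendingBefore (x k)) → s ∈ pending (x (suc t))
    survives-return {s = s} lt m s∈ carried with stack m | retSym m | return-step lt m | carried
    ... | s′ | _ | return _ _ _ othersKept restored | carried′ with s′ ≟ s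
    ...   | no s′≢s  = othersKept (x∈p∧x≢y⇒x∈p-y s∈ (s′≢s ∘ sym))
    ...   | yes refl = restored (carried′ refl)

    stays-pending : ∀ {i s a e} → w ! i ≡ just (call s a) → s ∈ pending (x i) → depthSince s i last ≡ just e →
                    ∀ t → i ≤ t → t < length w → s ∈ pending (x t)
    stays-pending {i} {s} at s∈ open′ = <-rec PendingFrom step
      where
      PendingFrom : ℕ → Set
      PendingFrom t = i ≤ t → t < length w → s ∈ pending (x t)
      step : ∀ t → (∀ {t′} → t′ < t → PendingFrom t′) → PendingFrom t
      step t ih i≤t t<n with m≤n⇒m<n∨m≡n i≤t
      ... | inj₂ refl = s∈
      step (suc t) ih _ t<n | inj₁ (s≤s i≤t) with !-defined (suc t) w t<n
      ... | c , at′ = dec-cases (s ∈? pending (x (suc t)))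
                        (λ (k , m) → survives-return t<n m s∈prev (carried m))
                        (λ unmatched → Internal.kept (internal-step at′ unmatched) s∈prev)
        where
        s∈prev : s ∈ pending (x t)
        s∈prev = ih ≤-refl i≤t (≤-trans (n≤1+n (suc t)) t<n)
        -- the matching call lies after i, so by induction s was pending just before it
        carried : ∀ {k} (m : Matched w k (suc t)) → stack m ≡ s → s ∈ pendingBefore (x k)
        carried m same with open-call-before-matched-call at open′ i≤t (<⇒≤∸1 t<n) m same
        ... | s≤s {n = k} i≤k = pending⊆pendingBefore k<n (ih (<⇒≤ (i<j m)) i≤k (<-trans (n<1+n k) k<n))
          where
          k<n : suc k < length w
          k<n = <-trans (i<j m) t<n

    calls-matched : .{{NonZero (length w)}} → ∀ i → i < length w → calling (q i) ≡ true →
                    ∃ λ j → Matched w i j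
    calls-matched i lt calls with calling-call lt calls
    ... | s , a , at , s∈ with depthSince s i last in open′
    ...   | nothing = underflow⇒matched at open′
    ...   | just _  = ⊥-elim (proj₂ (dec-true⁻ (final? (x last)) finalLast)
                               (s , stays-pending at s∈ open′ last (<⇒≤∸1 lt) (≤∸1⇒< ≤-refl)))

    accepting : .{{NonZero (length w)}} → IsAccepting B w q
    accepting = record
      { run = record
        { start   = λ c at → let x₀ , init , step = initial-step at
                             in control x₀ , proj₁ init , Internal.transition step
        ; stepRet = λ t k lt m → Return.transition (return-step lt m)
        ; stepInt = λ t c at unmatched → Internal.transition (internal-step at unmatched)
        }
      ; finalLast    = proj₁ (dec-true⁻ (final? (x last)) finalLast)
      ; callsMatched = calls-matched
      }

  module Completeness (w : List (Sym A)) (ρ : ℕ → Fin nstates) (acc : IsAccepting B w ρ) where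
    open IsAccepting acc
    open IsRun run
    open Nesting w
    open Segments w
    open StackHeight A using (height; height-++; step; step-underflow; height⇒wellFormed)
    open Matched

    IsCallOn : Fin K → Maybe (Sym A) → Set
    IsCallOn s c = ∃ λ a → c ≡ just (call s a)

    isCallOn? : ∀ s c → Dec (IsCallOn s c)
    isCallOn? s (just (call t a)) with t ≟ s
    ... | yes refl = yes (a , refl)
    ... | no t≢s   = no λ { (_ , refl) → t≢s refl }
    isCallOn? s (just (ret _ _)) = no λ { (_ , ()) }
    isCallOn? s (just (int _))   = no λ { (_ , ()) }
    isCallOn? s nothing          = no λ { (_ , ()) }

    OpenCall : Fin K → ℕ → ℕ → Set
    OpenCall s t k = calling (ρ k) ≡ true × IsCallOn s (w ! k) × Defined (depthSince s k t)

    Pending : ℕ → Fin K → Set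
    Pending t s = ∃ λ k → k < suc t × OpenCall s t k

    pending? : ∀ t s → Dec (Pending t s)
    pending? t s = anyUpTo? (λ k → (calling (ρ k) Bool.≟ true) ×-dec isCallOn? s (w ! k) ×-dec
                                   defined? (depthSince s k t)) (suc t)

    pendingAt : ℕ → Subset K
    pendingAt t = subset (pending? t)

    pendingBeforeAt : ℕ → Subset K
    pendingBeforeAt zero    = ⊥
    pendingBeforeAt (suc t) = pendingAt t

    pendingAt⁺ : ∀ {s t k} → k ≤ t → OpenCall s t k → s ∈ pendingAt t
    pendingAt⁺ {t = t} {k} k≤t open′ = ∈-subset⁺ (pending? t) (k , s≤s k≤t , open′)

    pendingAt⁻ : ∀ {s t} → s ∈ pendingAt t → ∃ λ k → k ≤ t × OpenCall s t k
    pendingAt⁻ {t = t} s∈ with ∈-subset⁻ (pending? t) s∈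
    ... | k , s≤s k≤t , open′ = k , k≤t , open′

    not-calling : ∀ t {c} → w ! t ≡ just c → (∀ s a → c ≢ call s a) → calling (ρ t) ≡ false
    not-calling t at not-call with calling (ρ t) in calls
    ... | false = refl
    ... | true with callsMatched t (!-< t w at) calls
    ...   | _ , m = ⊥-elim (not-call _ _ (just-injective (trans (sym at) (callAt m))))

    guarded : ∀ t {c} → w ! t ≡ just c → Guarded c (ρ t) (pendingAt t)
    guarded t {call s a} at calls =
      pendingAt⁺ ≤-refl (calls , (a , at) , 0 , cong (height s (just 0)) (segment-empty t))
    guarded t {ret _ _} at = not-calling t at λ _ _ ()
    guarded t {int _}   at = not-calling t at λ _ _ ()

    pending-step : ∀ {s t c} → s ∈ pendingAt t → w ! suc t ≡ just c →
                   s ∈ pendingAt (suc t) ⊎ ∃ λ k → Σ (Matched w k (suc t)) λ m → stack m ≡ s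
    pending-step {s} {t} {c} s∈ at with pendingAt⁻ s∈
    ... | k , k≤t , calls , (a , atk) , d , open′ with step s d c in stepped
    ...   | just d′ = inj₁ (pendingAt⁺ (≤-trans k≤t (n≤1+n t)) (calls , (a , atk) , d′ , extended))
      where
      extended : depthSince s k (suc t) ≡ just d′
      extended = begin
        depthSince s k (suc t)                    ≡⟨ cong (height s (just 0)) (segment-snoc k≤t at) ⟩
        height s (just 0) (segment k t ++ [ c ])  ≡⟨ height-++ s (just 0) (segment k t) [ c ] ⟩
        height s (depthSince s k t) [ c ]         ≡⟨ cong (λ h → height s h [ c ]) open′ ⟩
        step s d c                                ≡⟨ stepped ⟩
        just d′                                   ∎
        where open ≡-Reasoning
    ...   | nothing with step-underflow s d c stepped
    ...     | refl , b , refl = inj₂ (k , record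
              { stack = s ; callSym = a ; retSym = b ; i<j = s≤s k≤t ; callAt = atk ; retAt = at
              ; wf = height⇒wellFormed s (segment k t) open′ } , refl)

    pending-internal : ∀ {t c} → w ! suc t ≡ just c → ¬ (∃ λ k → Matched w k (suc t)) →
                       pendingAt t ⊆ pendingAt (suc t)
    pending-internal at unmatched s∈ with pending-step s∈ at
    ... | inj₁ s∈′         = s∈′
    ... | inj₂ (k , m , _) = ⊥-elim (unmatched (k , m))

    pending-return : ∀ {t k} (m : Matched w k (suc t)) → pendingAt t - stack m ⊆ pendingAt (suc t)
    pending-return {t} m s∈ with pending-step (p─q⊆p (pendingAt t) _ s∈) (retAt m)
    ... | inj₁ s∈′ = s∈′
    ... | inj₂ (_ , m′ , refl) =
      ⊥-elim (x∈p-y⇒x≢y (pendingAt t) s∈ (ret-injective (trans (sym (retAt m′)) (retAt m))))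

    pending-restored : ∀ {t k} (m : Matched w k (suc t)) →
                       stack m ∈ pendingBeforeAt k → stack m ∈ pendingAt (suc t)
    pending-restored {k = zero}  m s∈ = ⊥-elim (∉⊥ s∈)
    pending-restored {k = suc k} m s∈ with pendingAt⁻ s∈
    ... | k′ , k′≤k , calls , call-at , d , open′ =
      pendingAt⁺ (≤-trans k′≤k (≤-trans (n≤1+n k) (<⇒≤ (i<j m))))
                 (calls , call-at , d , depthSince-across-match k′≤k m open′)

    nothing-pending-at-end : .{{NonZero (length w)}} → Empty (pendingAt last)
    nothing-pending-at-end (s , s∈) with pendingAt⁻ s∈
    ... | k , k≤last , calls , (a , atk) , d , open′ with callsMatched k (≤∸1⇒< k≤last) calls
    ...   | j , m
      with stack m | matched-closes m (<⇒≤∸1 (!-< j w (retAt m))) | call-injective (trans (sym (callAt m)) atk)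
    ...     | _ | closed | refl with trans (sym open′) closed
    ...       | ()

    x : ℕ → State
    x t = ⟨ ρ t , pendingAt t , pendingBeforeAt t ⟩

    internal-step : ∀ {t c} → w ! suc t ≡ just c → ¬ (∃ λ k → Matched w k (suc t)) →
                    Internal (x t) c (x (suc t))
    internal-step {t} at unmatched =
      internal (stepInt t _ at unmatched) (λ s∈ → s∈) (pending-internal at unmatched) (guarded (suc t) at)

    return-step : ∀ {t k} → suc t < length w → (m : Matched w k (suc t)) →
                  Return (x k) (x t) (stack m , retSym m) (x (suc t))
    return-step {t} {k} lt m =
      return (stepRet t k lt m) (λ s∈ → s∈) (guarded (suc t) (retAt m)) (pending-return m) (pending-restored m)

    accepting : .{{NonZero (length w)}} → IsAccepting B′ w (encode ∘ x)
    accepting = record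
      { run = record
        { start   = λ c at → let q₀ , init , step = start c at
                                 x₀ = ⟨ q₀ , ⊥ , ⊥ ⟩
                             in encode x₀ , encode-initial x₀ (init , ∉⊥ ∘ proj₂) ,
                                encode-internal x₀ c (x 0) (internal step ⊥⊆ ⊥⊆ (guarded 0 at))
        ; stepRet = λ t k lt m → encode-return (x k) (x t) _ (x (suc t)) (return-step lt m)
        ; stepInt = λ t c at unmatched → encode-internal (x t) c (x (suc t)) (internal-step at unmatched)
        }
      ; finalLast    = encode-final (x last) (finalLast , nothing-pending-at-end)
      ; callsMatched = λ _ _ ()
      }

lemma2p7 : (K : ℕ) → .{{_ : NonZero K}} → (A : Alphabet K) → (B : GMNWA A) →
    Σ (GMNWA A) λ B′ → IsMNWA B′ ×
      ((w : List (Sym A)) → (Lang B′ w → Lang B w) × (Lang B w → Lang B′ w))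
lemma2p7 K A B = B′ , B′-isMNWA , λ w →
  (λ (nz , ρ′ , acc) → nz , _ , Soundness.accepting w ρ′ acc {{nz}}) ,
  (λ (nz , ρ  , acc) → nz , _ , Completeness.accepting w ρ acc {{nz}})
  where open Construction A B
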